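{- Let $k$ be a positive integer and $s\ge k$. Any graph with $n$ vertices and $e=6sn$ edges contains at least $\min\{s,\sqrt{sn}/k\}$ vertex-disjoint copies of the star $S_k$.
   Context: $S_k$ denotes the star with $k$ leaves. Floors of non-integer quantities are omitted. -}

module Defs where

open import Data.Nat using (ℕ; zero; suc; _+_; _*_; _<ᵇ_)
open import Data.Bool using (Bool; true; false; _∧_; if_then_else_)
open import Data.Fin using (Fin; toℕ)
open import Data.List using (List; map; allFin)
open import Data.Nat.ListAction using (sum)
open import Data.Maybe using (Maybe; just; nothing)
open import Data.Product using (_×_; Σ; _,_)
open import Relation.Binary.PropositionalEquality using (_≡_)

record Graph (n : ℕ) : Set where
  field
    adj   : Fin n → Fin n → Bool
    sym   : ∀ i j → adj i j ≡ adj j i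
    loopless : ∀ i → adj i i ≡ false
open Graph public

edgeCount : {n : ℕ} → Graph n → ℕ
edgeCount {n} G =
  sum (map (λ i → sum (map (λ j →
    if (toℕ i <ᵇ toℕ j) ∧ adj G i j then 1 else 0) (allFin n))) (allFin n))

-- Vertex (a, nothing) is the centre of the a-th star, (a, just l) its l-th leaf.
record DisjointStars {n : ℕ} (G : Graph n) (k t : ℕ) : Set where
  field
    vertex   : Fin t → Maybe (Fin k) → Fin n
    injective : ∀ a b x y → vertex a x ≡ vertex b y → (a ≡ b) × (x ≡ y)
    leafAdj  : ∀ a l → adj G (vertex a nothing) (vertex a (just l)) ≡ true

module Submission where

-- Grow a family of t disjoint stars S_k one star at a time for as long as e ≥ 6n(t+1) and
-- e ≥ 6(k(t+1))². Call a vertex used if it lies in some star, and high if it has at least 2k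
-- unused neighbours. An unused vertex with k unused neighbours becomes the centre of a new star;
-- a star containing two high vertices is replaced by two stars centred at them, each receiving k
-- unused leaves of its own. When neither move applies, charge every edge to a used endpoint, or
-- to its smaller endpoint if both are unused: an unused vertex is charged fewer than k edges,
-- there are at most t high used vertices, and any other used vertex is charged at most 2k + |U|,
-- where |U| ≤ t(k+1) is the number of used vertices. Hence e ≤ n(k−1) + nt + (2k + |U|)|U|,
-- which is incompatible with e ≥ 6kn and the two lower bounds above. Since there are at most n
-- disjoint stars, the process ends.

open import Defs hiding (sym)
open import Data.Bool using (Bool; true; false; _∧_; _∨_; not; if_then_else_; T)
open import Data.Bool.Properties using (∧-identityʳ; ∧-assoc; T-∧; T-∨; T-≡)
open import Data.Empty using (⊥; ⊥-elim)
open import Data.Fin using (Fin; zero; suc; toℕ; punchIn)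
open import Data.Fin.Properties using (_≟_; suc-injective; punchIn-injective; punchInᵢ≢i; any?; injective⇒≤)
open import Data.List using (map; allFin; tabulate)
open import Data.List.Properties using (map-tabulate)
open import Data.Maybe using (Maybe; just; nothing)
open import Data.Nat using (ℕ; zero; suc; pred; _+_; _*_; _^_; _≤_; _<_; z≤n; s≤s; z<s; _<ᵇ_; _≤ᵇ_; _≤?_; _<?_)
open import Data.Nat.ListAction using (sum)
open import Data.Nat.Properties hiding (_≟_; suc-injective)
open import Data.Nat.Tactic.RingSolver using (solve-∀)
open import Data.Product using (Σ; Σ-syntax; ∃; ∃₂; _×_; _,_; proj₁; proj₂)
open import Data.Sum using (_⊎_; inj₁; inj₂)
open import Data.Unit using (tt)
open import Function using (_∘_; id; Injective; Equivalence)
open import Relation.Binary.PropositionalEquality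
open import Relation.Nullary using (¬_; yes; no)
open import Relation.Nullary.Decidable using (does; dec-true; T?; _×-dec_)

open Equivalence using (to; from)

∑ : ∀ {n} → (Fin n → ℕ) → ℕ
∑ {zero}  f = 0
∑ {suc n} f = f zero + ∑ (f ∘ suc)

sum-tabulate : ∀ {n} (f : Fin n → ℕ) → sum (tabulate f) ≡ ∑ f
sum-tabulate {zero}  f = refl
sum-tabulate {suc n} f = cong (f zero +_) (sum-tabulate (f ∘ suc))

sum-map-allFin : ∀ {n} (f : Fin n → ℕ) → sum (map f (allFin n)) ≡ ∑ f
sum-map-allFin f = trans (cong sum (map-tabulate id f)) (sum-tabulate f)

∑-cong : ∀ {n} {f g : Fin n → ℕ} → (∀ i → f i ≡ g i) → ∑ f ≡ ∑ g
∑-cong {zero}  f≗g = refl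
∑-cong {suc n} f≗g = cong₂ _+_ (f≗g zero) (∑-cong (f≗g ∘ suc))

∑-mono : ∀ {n} {f g : Fin n → ℕ} → (∀ i → f i ≤ g i) → ∑ f ≤ ∑ g
∑-mono {zero}  f≤g = z≤n
∑-mono {suc n} f≤g = +-mono-≤ (f≤g zero) (∑-mono (f≤g ∘ suc))

∑-+ : ∀ {n} (f g : Fin n → ℕ) → ∑ (λ i → f i + g i) ≡ ∑ f + ∑ g
∑-+ {zero}  f g = refl
∑-+ {suc n} f g = begin
  f zero + g zero + ∑ (λ i → f (suc i) + g (suc i))  ≡⟨ cong (f zero + g zero +_) (∑-+ (f ∘ suc) (g ∘ suc)) ⟩
  f zero + g zero + (∑ (f ∘ suc) + ∑ (g ∘ suc))       ≡⟨ +-+-comm (f zero) (g zero) _ _ ⟩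
  f zero + ∑ (f ∘ suc) + (g zero + ∑ (g ∘ suc))       ∎
  where
  open ≡-Reasoning
  +-+-comm : ∀ a b c d → a + b + (c + d) ≡ a + c + (b + d)
  +-+-comm = solve-∀

∑-const : ∀ n c → ∑ {n} (λ _ → c) ≡ n * c
∑-const zero    c = refl
∑-const (suc n) c = cong (c +_) (∑-const n c)

∑-*ˡ : ∀ {n} c (f : Fin n → ℕ) → ∑ (λ i → c * f i) ≡ c * ∑ f
∑-*ˡ {zero}  c f = sym (*-zeroʳ c)
∑-*ˡ {suc n} c f = trans (cong (c * f zero +_) (∑-*ˡ c (f ∘ suc))) (sym (*-distribˡ-+ c (f zero) _))

∑-comm : ∀ {m n} (f : Fin m → Fin n → ℕ) → ∑ (λ i → ∑ (f i)) ≡ ∑ (λ j → ∑ (λ i → f i j))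
∑-comm {zero}  {n} f = sym (trans (∑-const n 0) (*-zeroʳ n))
∑-comm {suc m} f = trans (cong (∑ (f zero) +_) (∑-comm (f ∘ suc))) (sym (∑-+ (f zero) _))

ind : Bool → ℕ
ind b = if b then 1 else 0

count : ∀ {n} → (Fin n → Bool) → ℕ
count p = ∑ (λ i → ind (p i))

ind-mono : ∀ {a b} → (T a → T b) → ind a ≤ ind b
ind-mono {false}          a⇒b = z≤n
ind-mono {true}  {true}   a⇒b = ≤-refl
ind-mono {true}  {false}  a⇒b = ⊥-elim (a⇒b tt)

count-mono : ∀ {n} {p q : Fin n → Bool} → (∀ i → T (p i) → T (q i)) → count p ≤ count q
count-mono p⇒q = ∑-mono (λ i → ind-mono (p⇒q i))

count-false : ∀ n → count {n} (λ _ → false) ≡ 0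
count-false n = trans (∑-const n 0) (*-zeroʳ n)

count-true : ∀ n → count {n} (λ _ → true) ≡ n
count-true n = trans (∑-const n 1) (*-identityʳ n)

count≤n : ∀ {n} (p : Fin n → Bool) → count p ≤ n
count≤n {n} p = ≤-trans (count-mono {n} {q = λ _ → true} (λ _ _ → tt)) (≤-reflexive (count-true n))

count-∨ : ∀ {n} (p q : Fin n → Bool) → count (λ i → p i ∨ q i) ≤ count p + count q
count-∨ {n} p q = ≤-trans (∑-mono (λ i → ind-∨ (p i) (q i))) (≤-reflexive (∑-+ {n} _ _))
  where
  ind-∨ : ∀ a b → ind (a ∨ b) ≤ ind a + ind b
  ind-∨ true  b = s≤s z≤n
  ind-∨ false b = ≤-refl

ind-split : ∀ a b → ind a ≡ ind (a ∧ b) + ind (a ∧ not b)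
ind-split false b     = refl
ind-split true  true  = refl
ind-split true  false = refl

count-split : ∀ {n} (p q : Fin n → Bool) → count p ≡ count (λ i → p i ∧ q i) + count (λ i → p i ∧ not (q i))
count-split {n} p q = trans (∑-cong (λ i → ind-split (p i) (q i))) (∑-+ {n} _ _)

count-≟∧ : ∀ {n} (c : Fin n) (p : Fin n → Bool) → count (λ j → does (c ≟ j) ∧ p j) ≡ ind (p c)
count-≟∧ {suc n} zero    p = trans (cong (ind (p zero) +_) (count-false n)) (+-identityʳ _)
count-≟∧ {suc n} (suc c) p = count-≟∧ c (p ∘ suc)

count-≟ : ∀ {n} (c : Fin n) → count (λ j → does (c ≟ j)) ≡ 1
count-≟ {n} c = trans (∑-cong {n} (λ j → cong ind (sym (∧-identityʳ _)))) (count-≟∧ c (λ _ → true))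

count≤count+count∧not : ∀ {n} (p q : Fin n → Bool) → count p ≤ count q + count (λ i → p i ∧ not (q i))
count≤count+count∧not {n} p q = begin
  count p                                                         ≡⟨ count-split p q ⟩
  count (λ i → p i ∧ q i) + count (λ i → p i ∧ not (q i))         ≤⟨ +-monoˡ-≤ _ (count-mono {n} (λ i → proj₂ ∘ T-∧ {p i} .to)) ⟩
  count q + count (λ i → p i ∧ not (q i))                         ∎
  where open ≤-Reasoning

⋁ : ∀ {m} → (Fin m → Bool) → Bool
⋁ {zero}  p = false
⋁ {suc m} p = p zero ∨ ⋁ (p ∘ suc)

⋁-intro : ∀ {m} (p : Fin m → Bool) a → T (p a) → T (⋁ p)
⋁-intro p zero    pa with p zero
... | true = tt
⋁-intro p (suc a) pa with p zero
... | true  = tt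
... | false = ⋁-intro (p ∘ suc) a pa

⋁-elim : ∀ {m} (p : Fin m → Bool) → T (⋁ p) → ∃ (λ a → T (p a))
⋁-elim {suc m} p h with p zero in eq
... | true  = zero , subst T (sym eq) tt
... | false with a , pa ← ⋁-elim (p ∘ suc) h = suc a , pa

count-⋁ : ∀ {m n} (q : Fin m → Fin n → Bool) → count (λ j → ⋁ (λ a → q a j)) ≤ ∑ (λ a → count (q a))
count-⋁ {zero} {n} q = ≤-reflexive (count-false n)
count-⋁ {suc m} q = ≤-trans (count-∨ (q zero) _) (+-monoʳ-≤ (count (q zero)) (count-⋁ (q ∘ suc)))

count-image : ∀ {m n} (f : Fin m → Fin n) → count (λ j → ⋁ λ l → does (f l ≟ j)) ≤ m
count-image {m} f = begin
  count (λ j → ⋁ λ l → does (f l ≟ j))        ≤⟨ count-⋁ (λ l j → does (f l ≟ j)) ⟩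
  ∑ (λ l → count (λ j → does (f l ≟ j)))      ≡⟨ ∑-cong {m} (λ l → count-≟ (f l)) ⟩
  count {m} (λ _ → true)                      ≡⟨ count-true m ⟩
  m                                           ∎
  where open ≤-Reasoning

pick : ∀ {n} (p : Fin n → Bool) {k} → k ≤ count p →
  Σ[ f ∈ (Fin k → Fin n) ] Injective _≡_ _≡_ f × (∀ l → T (p (f l)))
pick p {zero} _ = (λ ()) , (λ { {()} }) , (λ ())
pick {suc n} p {suc k} k<count with p zero in eq
... | true  with f , f-inj , f-p ← pick (p ∘ suc) (≤-pred k<count) = F , F-inj , F-p
  where
  F : Fin (suc k) → Fin (suc n)
  F zero    = zero
  F (suc l) = suc (f l)
  F-inj : Injective _≡_ _≡_ F
  F-inj {zero}  {zero}  _ = refl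
  F-inj {suc l} {suc l′} e = cong suc (f-inj (suc-injective e))
  F-p : ∀ l → T (p (F l))
  F-p zero    = subst T (sym eq) tt
  F-p (suc l) = f-p l
... | false with f , f-inj , f-p ← pick (p ∘ suc) k<count = suc ∘ f , f-inj ∘ suc-injective , f-p

T-not⇒¬T : ∀ {b} → T (not b) → ¬ T b
T-not⇒¬T {true} ()

does-≟-diag : ∀ {n} (i : Fin n) → T (does (i ≟ i))
does-≟-diag i = subst T (sym (dec-true (i ≟ i) refl)) tt

does-≟⇒≡ : ∀ {n} {i j : Fin n} → T (does (i ≟ j)) → i ≡ j
does-≟⇒≡ {i = i} {j} h with i ≟ j
... | yes i≡j = i≡j


ind-orient : ∀ lt a o o′ lt′ → (T lt → T (o ∨ o′)) → (T lt → T (not lt′)) →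
  ind (lt ∧ a) ≤ ind ((a ∧ o) ∧ lt) + ind ((a ∧ o′) ∧ not lt′)
ind-orient false a     o     o′    lt′   _     _    = z≤n
ind-orient true  false o     o′    lt′   _     _    = z≤n
ind-orient true  true  true  o′    lt′   _     _    = s≤s z≤n
ind-orient true  true  false true  false _     _    = s≤s z≤n
ind-orient true  true  false false lt′   cover _    = ⊥-elim (cover tt)
ind-orient true  true  false true  true  _     asym = ⊥-elim (asym tt)

_≺_ : ∀ {n} → Fin n → Fin n → Bool
i ≺ j = toℕ i <ᵇ toℕ j

≺-asym : ∀ {n} (i j : Fin n) → T (i ≺ j) → T (not (j ≺ i))
≺-asym i j i≺j with j ≺ i in eq
... | false = tt
... | true  = <-asym (<ᵇ⇒< (toℕ i) (toℕ j) i≺j) (<ᵇ⇒< (toℕ j) (toℕ i) (subst T (sym eq) tt))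

module _ {n : ℕ} (G : Graph n) where

  edgeCount≡∑∑ : edgeCount G ≡ ∑ (λ i → count (λ j → i ≺ j ∧ adj G i j))
  edgeCount≡∑∑ = trans (sum-map-allFin {n} _) (∑-cong {n} (λ i → sum-map-allFin {n} _))

  edgeCount≤∑outDegree : (O : Fin n → Fin n → Bool) → (∀ i j → T (i ≺ j) → T (O i j ∨ O j i)) →
    edgeCount G ≤ ∑ (λ i → count (λ j → adj G i j ∧ O i j))
  edgeCount≤∑outDegree O cover = begin
    edgeCount G                                                 ≡⟨ edgeCount≡∑∑ ⟩
    ∑ (λ i → count (λ j → i ≺ j ∧ adj G i j))                   ≤⟨ ∑-mono {n} (λ i → ∑-mono (pointwise i)) ⟩
    ∑ (λ i → ∑ (λ j → forward i j + backward j i))             ≡⟨ ∑-cong {n} (λ i → ∑-+ {n} _ _) ⟩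
    ∑ (λ i → ∑ (forward i) + ∑ (λ j → backward j i))           ≡⟨ ∑-+ {n} _ _ ⟩
    ∑ (λ i → ∑ (forward i)) + ∑ (λ i → ∑ (λ j → backward j i)) ≡⟨ cong (∑ (∑ ∘ forward) +_) (∑-comm (λ i j → backward j i)) ⟩
    ∑ (λ i → ∑ (forward i)) + ∑ (λ j → ∑ (backward j))         ≡⟨ sym (∑-+ {n} _ _) ⟩
    ∑ (λ i → ∑ (forward i) + ∑ (backward i))                   ≡⟨ ∑-cong {n} (λ i → sym (count-split (out i) (i ≺_))) ⟩
    ∑ (λ i → count (out i))                                     ∎
    where
    open ≤-Reasoning
    out : Fin n → Fin n → Bool
    out i j = adj G i j ∧ O i j
    forward backward : Fin n → Fin n → ℕ
    forward  i j = ind (out i j ∧ i ≺ j)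
    backward i j = ind (out i j ∧ not (i ≺ j))
    -- An edge with i ≺ j is charged to i if O i j holds, and otherwise to j, where it is backward.
    pointwise : ∀ i j → ind (i ≺ j ∧ adj G i j) ≤ forward i j + backward j i
    pointwise i j rewrite Graph.sym G j i =
      ind-orient (i ≺ j) (adj G i j) (O i j) (O j i) (j ≺ i) (cover i j) (≺-asym i j)

saturation-bound-absurd : ∀ {k n t e H U} → 1 ≤ k → H ≤ t → U ≤ t * suc k →
  e ≤ n * pred k + n * H + (k + k + U) * U →
  6 * k * n ≤ e → 6 * n * suc t ≤ e → 6 * (k * suc t) ^ 2 ≤ e → ⊥
saturation-bound-absurd {suc k′} {n} {t} {e} {H} {U} _ H≤t U≤t[k+1] e≤ 6kn≤e 6n[t+1]≤e 6[k[t+1]]²≤e =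
  <-irrefl refl (begin-strict
    6 * e                                                  ≤⟨ *-monoʳ-≤ 6 e≤X ⟩
    6 * X                                                  <⟨ m<m+n (6 * X) z<s ⟩
    6 * X + (24 * K * K * suc t + 12 * n)                  ≡⟨ identity k′ n t ⟩
    6 * K * n + 6 * n * suc t + 4 * (6 * (K * suc t) ^ 2)  ≤⟨ +-mono-≤ (+-mono-≤ 6kn≤e 6n[t+1]≤e) (*-monoʳ-≤ 4 6[k[t+1]]²≤e) ⟩
    e + e + 4 * e                                          ≡⟨ six e ⟩
    6 * e                                                  ∎)
  where
  open ≤-Reasoning
  K = suc k′
  V = t * (K + K)
  X = n * k′ + n * t + (K + K + V) * V
  U≤V : U ≤ V
  U≤V = ≤-trans U≤t[k+1] (*-monoʳ-≤ t (s≤s (m≤n+m K k′)))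
  e≤X : e ≤ X
  e≤X = ≤-trans e≤ (+-mono-≤ (+-monoʳ-≤ (n * k′) (*-monoʳ-≤ n H≤t)) (*-mono-≤ (+-monoʳ-≤ (K + K) U≤V) U≤V))
  identity : ∀ k n t →
    6 * (n * k + n * t + ((1 + k) + (1 + k) + t * ((1 + k) + (1 + k))) * (t * ((1 + k) + (1 + k))))
      + (24 * (1 + k) * (1 + k) * (1 + t) + 12 * n)
    ≡ 6 * (1 + k) * n + 6 * n * (1 + t) + 4 * (6 * (((1 + k) * (1 + t)) * (((1 + k) * (1 + t)) * 1)))
  identity = solve-∀
  six : ∀ e → e + e + 4 * e ≡ 6 * e
  six = solve-∀

adjacent⇒≢ : ∀ {n} (G : Graph n) {i j} → T (adj G i j) → i ≢ j
adjacent⇒≢ G {i} i~i refl = subst T (Graph.loopless G i) i~i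

module StarPacking {n : ℕ} (G : Graph n) (k : ℕ) where

  record Star : Set where
    field
      centre         : Fin n
      leaf           : Fin k → Fin n
      leaf-injective : Injective _≡_ _≡_ leaf
      leaf-adjacent  : ∀ l → T (adj G centre (leaf l))

    vertex : Fin (suc k) → Fin n
    vertex zero    = centre
    vertex (suc l) = leaf l

    vertex-injective : Injective _≡_ _≡_ vertex
    vertex-injective {zero}  {zero}   _ = refl
    vertex-injective {zero}  {suc l}  e = ⊥-elim (adjacent⇒≢ G (leaf-adjacent l) e)
    vertex-injective {suc l} {zero}   e = ⊥-elim (adjacent⇒≢ G (leaf-adjacent l) (sym e))
    vertex-injective {suc l} {suc l′} e = cong suc (leaf-injective e)

  open Star using (leaf; vertex)

  starAt : (c : Fin n) (q : Fin n → Bool) → k ≤ count (λ j → adj G c j ∧ q j) → Star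
  starAt c q enough with f , f-injective , f-good ← pick (λ j → adj G c j ∧ q j) enough = record
    { centre         = c
    ; leaf           = f
    ; leaf-injective = f-injective
    ; leaf-adjacent  = λ l → proj₁ (T-∧ .to (f-good l))
    }

  starAt-leaf : ∀ c (q : Fin n → Bool) enough l → T (q (leaf (starAt c q enough) l))
  starAt-leaf c q enough l with f , f-injective , f-good ← pick (λ j → adj G c j ∧ q j) enough =
    proj₂ (T-∧ .to (f-good l))

  record Packing (t : ℕ) : Set where
    field
      star     : Fin t → Star
      disjoint : ∀ a b x y → vertex (star a) x ≡ vertex (star b) y → a ≡ b × x ≡ y

    vertexOf : Fin t → Fin (suc k) → Fin n
    vertexOf a = vertex (star a)

  open Packing

  Avoids : ∀ {t} → Packing t → Fin n → Set
  Avoids P v = ∀ a x → vertexOf P a x ≢ v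

  empty : Packing 0
  empty = record { star = λ () ; disjoint = λ () }

  add : ∀ {t} (P : Packing t) (S : Star) → (∀ x → Avoids P (vertex S x)) → Packing (suc t)
  add {t} P S avoids = record { star = stars ; disjoint = disjoint′ }
    where
    stars : Fin (suc t) → Star
    stars zero    = S
    stars (suc a) = star P a
    disjoint′ : ∀ a b x y → vertex (stars a) x ≡ vertex (stars b) y → a ≡ b × x ≡ y
    disjoint′ zero    zero    x y e = refl , Star.vertex-injective S e
    disjoint′ zero    (suc b) x y e = ⊥-elim (avoids x b y (sym e))
    disjoint′ (suc a) zero    x y e = ⊥-elim (avoids y a x e)
    disjoint′ (suc a) (suc b) x y e with refl , x≡y ← disjoint P a b x y e = refl , x≡y

  add-avoids : ∀ {t} (P : Packing t) (S : Star) avoids {v} →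
    Avoids P v → (∀ x → vertex S x ≢ v) → Avoids (add P S avoids) v
  add-avoids P S avoids P-avoids S-avoids zero    = S-avoids
  add-avoids P S avoids P-avoids S-avoids (suc a) = P-avoids a

  remove : ∀ {t} → Packing (suc t) → Fin (suc t) → Packing t
  remove P b = record
    { star     = star P ∘ punchIn b
    ; disjoint = λ a a′ x y e → let a≡a′ , x≡y = disjoint P _ _ x y e in punchIn-injective b a a′ a≡a′ , x≡y
    }

  remove-avoids : ∀ {t} (P : Packing (suc t)) b {v} → Avoids P v → Avoids (remove P b) v
  remove-avoids P b P-avoids = P-avoids ∘ punchIn b

  removed-avoids : ∀ {t} (P : Packing (suc t)) b x → Avoids (remove P b) (vertexOf P b x)
  removed-avoids P b x a y e = punchInᵢ≢i b a (proj₁ (disjoint P _ _ y x e))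

  isUsed : ∀ {t} → Packing t → Fin n → Bool
  isUsed P j = ⋁ λ a → ⋁ λ x → does (vertexOf P a x ≟ j)

  isUsed-vertexOf : ∀ {t} (P : Packing t) a x → T (isUsed P (vertexOf P a x))
  isUsed-vertexOf P a x =
    ⋁-intro (λ a′ → ⋁ λ x′ → does (vertexOf P a′ x′ ≟ v)) a
      (⋁-intro (λ x′ → does (vertexOf P a x′ ≟ v)) x (does-≟-diag v))
    where v = vertexOf P a x

  isUsed⇒vertexOf : ∀ {t} (P : Packing t) {j} → T (isUsed P j) → ∃₂ λ a x → vertexOf P a x ≡ j
  isUsed⇒vertexOf P {j} used
    with a , used-in-a ← ⋁-elim (λ a → ⋁ λ x → does (vertexOf P a x ≟ j)) used
    with x , hit ← ⋁-elim (λ x → does (vertexOf P a x ≟ j)) used-in-a = a , x , does-≟⇒≡ hit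

  unused⇒avoids : ∀ {t} (P : Packing t) {v} → T (not (isUsed P v)) → Avoids P v
  unused⇒avoids P unused a x refl = T-not⇒¬T unused (isUsed-vertexOf P a x)

  count-isUsed∧ : ∀ {t} (P : Packing t) (q : Fin n → Bool) →
    count (λ j → isUsed P j ∧ q j) ≤ ∑ (λ a → count (λ x → q (vertexOf P a x)))
  count-isUsed∧ {t} P q = begin
    count (λ j → isUsed P j ∧ q j)                    ≤⟨ count-mono {n} lift ⟩
    count (λ j → ⋁ λ a → ⋁ λ x → hit a x j)           ≤⟨ count-⋁ (λ a j → ⋁ λ x → hit a x j) ⟩
    ∑ (λ a → count (λ j → ⋁ λ x → hit a x j))         ≤⟨ ∑-mono {t} (λ a → count-⋁ (hit a)) ⟩
    ∑ (λ a → ∑ (λ x → count (hit a x)))               ≡⟨ ∑-cong {t} (λ a → ∑-cong {suc k} (λ x → count-≟∧ (vertexOf P a x) q)) ⟩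
    ∑ (λ a → count (λ x → q (vertexOf P a x)))        ∎
    where
    open ≤-Reasoning
    hit : Fin t → Fin (suc k) → Fin n → Bool
    hit a x j = does (vertexOf P a x ≟ j) ∧ q j
    lift : ∀ j → T (isUsed P j ∧ q j) → T (⋁ λ a → ⋁ λ x → hit a x j)
    lift j used∧q with used , qj ← T-∧ .to used∧q with a , x , refl ← isUsed⇒vertexOf P used =
      ⋁-intro (λ a′ → ⋁ λ x′ → hit a′ x′ j) a
        (⋁-intro (λ x′ → hit a x′ j) x (T-∧ .from (does-≟-diag j , qj)))

  count-isUsed : ∀ {t} (P : Packing t) → count (isUsed P) ≤ t * suc k
  count-isUsed {t} P = begin
    count (isUsed P)                          ≤⟨ count-mono {n} (λ j used → T-∧ .from (used , tt)) ⟩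
    count (λ j → isUsed P j ∧ true)           ≤⟨ count-isUsed∧ P (λ _ → true) ⟩
    ∑ {t} (λ _ → count {suc k} (λ _ → true))  ≡⟨ ∑-cong {t} (λ a → count-true (suc k)) ⟩
    ∑ {t} (λ _ → suc k)                       ≡⟨ ∑-const t (suc k) ⟩
    t * suc k                                 ∎
    where open ≤-Reasoning

  freeDegree : ∀ {t} → Packing t → Fin n → ℕ
  freeDegree P i = count (λ j → adj G i j ∧ not (isUsed P j))

  isHigh : ∀ {t} → Packing t → Fin n → Bool
  isHigh P i = k + k ≤ᵇ freeDegree P i

  highCount : ∀ {t} → Packing t → Fin t → ℕ
  highCount P a = count (λ x → isHigh P (vertexOf P a x))

  count-used-high : ∀ {t} (P : Packing t) → (∀ a → highCount P a ≤ 1) →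
    count (λ j → isUsed P j ∧ isHigh P j) ≤ t
  count-used-high {t} P ≤1 = begin
    count (λ j → isUsed P j ∧ isHigh P j) ≤⟨ count-isUsed∧ P (isHigh P) ⟩
    ∑ (highCount P)                       ≤⟨ ∑-mono ≤1 ⟩
    ∑ {t} (λ _ → 1)                       ≡⟨ count-true t ⟩
    t                                     ∎
    where open ≤-Reasoning

  addStarAt : ∀ {t} (P : Packing t) c → T (not (isUsed P c)) → k ≤ freeDegree P c → Packing (suc t)
  addStarAt P c c-unused enough = add P S S-avoids
    where
    S = starAt c (not ∘ isUsed P) enough
    S-avoids : ∀ x → Avoids P (vertex S x)
    S-avoids zero    = unused⇒avoids P c-unused
    S-avoids (suc l) = unused⇒avoids P (starAt-leaf c (not ∘ isUsed P) enough l)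

  splitStar : ∀ {t} (P : Packing (suc t)) b {x y} → x ≢ y →
    T (isHigh P (vertexOf P b x)) → T (isHigh P (vertexOf P b y)) → Packing (suc (suc t))
  splitStar P b {x} {y} x≢y x-high y-high = add P₂ Sy Sy-avoids
    where
    cx = vertexOf P b x
    cy = vertexOf P b y
    unused : Fin n → Bool
    unused j = not (isUsed P j)
    P-avoids : ∀ {j} → T (unused j) → Avoids P j
    P-avoids = unused⇒avoids P
    2k≤ : ∀ z → T (isHigh P (vertexOf P b z)) → k + k ≤ freeDegree P (vertexOf P b z)
    2k≤ z high = ≤ᵇ⇒≤ (k + k) _ high

    Sx = starAt cx unused (≤-trans (m≤m+n k k) (2k≤ x x-high))
    Sx-leaf-unused : ∀ l → T (unused (leaf Sx l))
    Sx-leaf-unused = starAt-leaf cx unused _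
    P₁ = remove P b
    Sx-avoids : ∀ z → Avoids P₁ (vertex Sx z)
    Sx-avoids zero    = removed-avoids P b x
    Sx-avoids (suc l) = remove-avoids P b (P-avoids (Sx-leaf-unused l))
    P₂ = add P₁ Sx Sx-avoids

    isLeafOfSx : Fin n → Bool
    isLeafOfSx j = ⋁ λ l → does (leaf Sx l ≟ j)
    Sx-leaf-isLeafOfSx : ∀ l → T (isLeafOfSx (leaf Sx l))
    Sx-leaf-isLeafOfSx l = ⋁-intro (λ l′ → does (leaf Sx l′ ≟ leaf Sx l)) l (does-≟-diag (leaf Sx l))
    candidate : Fin n → Bool
    candidate j = unused j ∧ not (isLeafOfSx j)
    enough : k ≤ count (λ j → adj G cy j ∧ candidate j)
    enough = +-cancelˡ-≤ k _ _ (begin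
      k + k                                                         ≤⟨ 2k≤ y y-high ⟩
      freeDegree P cy                                               ≤⟨ count≤count+count∧not (λ j → adj G cy j ∧ unused j) isLeafOfSx ⟩
      count isLeafOfSx
        + count (λ j → (adj G cy j ∧ unused j) ∧ not (isLeafOfSx j)) ≡⟨ cong (count isLeafOfSx +_)
                                                                           (∑-cong {n} λ j → cong ind (∧-assoc (adj G cy j) _ _)) ⟩
      count isLeafOfSx + count (λ j → adj G cy j ∧ candidate j)     ≤⟨ +-monoˡ-≤ _ (count-image (leaf Sx)) ⟩
      k + count (λ j → adj G cy j ∧ candidate j)                    ∎)
      where open ≤-Reasoning
    Sy = starAt cy candidate enough
    Sy-leaf-candidate : ∀ l → T (candidate (leaf Sy l))
    Sy-leaf-candidate = starAt-leaf cy candidate enough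

    Sy-avoids : ∀ z → Avoids P₂ (vertex Sy z)
    Sy-avoids zero = add-avoids P₁ Sx Sx-avoids (removed-avoids P b y) λ
      { zero    → λ cx≡cy → x≢y (proj₂ (disjoint P b b x y cx≡cy))
      ; (suc l) → ≢-sym (P-avoids (Sx-leaf-unused l) b y)
      }
    Sy-avoids (suc l) with Sy-leaf-unused , Sy-leaf-fresh ← T-∧ .to (Sy-leaf-candidate l) =
      add-avoids P₁ Sx Sx-avoids (remove-avoids P b (P-avoids Sy-leaf-unused)) λ
        { zero     → P-avoids Sy-leaf-unused b x
        ; (suc l′) → λ e → T-not⇒¬T Sy-leaf-fresh (subst (T ∘ isLeafOfSx) e (Sx-leaf-isLeafOfSx l′))
        }

  oriented : ∀ {t} → Packing t → Fin n → Fin n → Bool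
  oriented P i j = isUsed P i ∨ (not (isUsed P j) ∧ i ≺ j)

  oriented-covers : ∀ {t} (P : Packing t) i j → T (i ≺ j) → T (oriented P i j ∨ oriented P j i)
  oriented-covers P i j i≺j with isUsed P i | isUsed P j
  ... | true  | _     = tt
  ... | false | true  = tt
  ... | false | false = T-∨ .from (inj₁ i≺j)

  outDegree≤ : ∀ {t} (P : Packing t) → (∀ i → T (not (isUsed P i)) → freeDegree P i < k) → ∀ i →
    count (λ j → adj G i j ∧ oriented P i j)
      ≤ pred k + n * ind (isUsed P i ∧ isHigh P i) + (k + k + count (isUsed P)) * ind (isUsed P i)
  outDegree≤ P small i with isUsed P i in used
  ... | false = ≤-trans (<⇒≤pred (≤-trans (s≤s to-unused) (small i (subst (T ∘ not) (sym used) tt))))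
                        (≤-trans (m≤m+n _ _) (m≤m+n _ _))
    where
    to-unused : count (λ j → adj G i j ∧ (not (isUsed P j) ∧ i ≺ j)) ≤ freeDegree P i
    to-unused = count-mono {n} λ j i~j∧unused∧≺ →
      let i~j , unused∧≺ = T-∧ {adj G i j} .to i~j∧unused∧≺
      in  T-∧ .from (i~j , proj₁ (T-∧ {not (isUsed P j)} .to unused∧≺))
  ... | true with isHigh P i in high
  ...   | true = ≤-trans (count≤n _)
                   (≤-trans (≤-reflexive (sym (*-identityʳ n))) (≤-trans (m≤n+m (n * 1) (pred k)) (m≤m+n _ _)))
  ...   | false = begin
    count (λ j → adj G i j ∧ true)                                 ≤⟨ count≤count+count∧not (λ j → adj G i j ∧ true) (isUsed P) ⟩
    count (isUsed P)
      + count (λ j → (adj G i j ∧ true) ∧ not (isUsed P j))        ≡⟨ cong (count (isUsed P) +_) (∑-cong {n} λ j →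
                                                                        cong (λ a → ind (a ∧ not (isUsed P j))) (∧-identityʳ (adj G i j))) ⟩
    count (isUsed P) + freeDegree P i                              ≤⟨ +-monoʳ-≤ (count (isUsed P)) (<⇒≤ low) ⟩
    count (isUsed P) + (k + k)                                     ≡⟨ +-comm (count (isUsed P)) (k + k) ⟩
    k + k + count (isUsed P)                                       ≡⟨ sym (*-identityʳ _) ⟩
    (k + k + count (isUsed P)) * 1                                 ≤⟨ m≤n+m _ _ ⟩
    pred k + n * 0 + (k + k + count (isUsed P)) * 1                ∎
    where
    open ≤-Reasoning
    low : freeDegree P i < k + k
    low = ≰⇒> λ 2k≤ → subst T high (≤⇒≤ᵇ 2k≤)

  edgeCount-saturated : ∀ {t} (P : Packing t) → (∀ i → T (not (isUsed P i)) → freeDegree P i < k) →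
    edgeCount G ≤ n * pred k + n * count (λ i → isUsed P i ∧ isHigh P i)
                   + (k + k + count (isUsed P)) * count (isUsed P)
  edgeCount-saturated P small = begin
    edgeCount G                                         ≤⟨ edgeCount≤∑outDegree G (oriented P) (oriented-covers P) ⟩
    ∑ (λ i → count (λ j → adj G i j ∧ oriented P i j)) ≤⟨ ∑-mono {n} (outDegree≤ P small) ⟩
    ∑ (λ i → pred k + n * high i + C * used i)          ≡⟨ ∑-+ {n} _ _ ⟩
    ∑ (λ i → pred k + n * high i) + ∑ (λ i → C * used i) ≡⟨ cong₂ _+_ (trans (∑-+ {n} _ _) (cong₂ _+_ (∑-const n (pred k)) (∑-*ˡ n high)))
                                                                        (∑-*ˡ C used) ⟩
    n * pred k + n * ∑ high + C * ∑ used                ∎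
    where
    open ≤-Reasoning
    C = k + k + count (isUsed P)
    high used : Fin n → ℕ
    high i = ind (isUsed P i ∧ isHigh P i)
    used i = ind (isUsed P i)

  splitStarAt : ∀ {t} (P : Packing t) b → 2 ≤ highCount P b → Packing (suc t)
  splitStarAt {suc t} P b two-high with h , h-injective , h-high ← pick (λ x → isHigh P (vertexOf P b x)) two-high =
    splitStar P b (λ h0≡h1 → case (h-injective h0≡h1)) (h-high zero) (h-high (suc zero))
    where
    case : zero ≢ suc zero
    case ()

  enlarge : ∀ {t} → 1 ≤ k → 6 * k * n ≤ edgeCount G →
    6 * n * suc t ≤ edgeCount G → 6 * (k * suc t) ^ 2 ≤ edgeCount G → Packing t → Packing (suc t)
  enlarge 1≤k 6kn≤e 6n[t+1]≤e 6[k[t+1]]²≤e P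
    with any? (λ c → T? (not (isUsed P c)) ×-dec (k ≤? freeDegree P c))
  ... | yes (c , c-unused , enough) = addStarAt P c c-unused enough
  ... | no ¬growable with any? (λ b → 2 ≤? highCount P b)
  ...   | yes (b , two-high) = splitStarAt P b two-high
  ...   | no ¬splittable = ⊥-elim (saturation-bound-absurd 1≤k
          (count-used-high P (λ b → ≤-pred (≰⇒> (¬splittable ∘ (b ,_)))))
          (count-isUsed P)
          (edgeCount-saturated P (λ c c-unused → ≰⇒> (¬growable ∘ (λ enough → c , c-unused , enough))))
          6kn≤e 6n[t+1]≤e 6[k[t+1]]²≤e)

  size≤n : ∀ {t} → Packing t → t ≤ n
  size≤n P = injective⇒≤ (λ centres≡ → proj₁ (disjoint P _ _ zero zero centres≡))

  enlarge-until-bound : 1 ≤ k → 6 * k * n ≤ edgeCount G → ∀ fuel {t} → n < fuel + t → Packing t →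
    Σ ℕ λ t′ → Packing t′ × (edgeCount G < 6 * n * suc t′ ⊎ edgeCount G < 6 * (k * suc t′) ^ 2)
  enlarge-until-bound 1≤k 6kn≤e zero       n<t        P = ⊥-elim (<⇒≱ n<t (size≤n P))
  enlarge-until-bound 1≤k 6kn≤e (suc fuel) {t} n<fuel+t P
    with edgeCount G <? 6 * n * suc t | edgeCount G <? 6 * (k * suc t) ^ 2
  ... | yes few | _       = t , P , inj₁ few
  ... | no _    | yes few = t , P , inj₂ few
  ... | no many | no many′ = enlarge-until-bound 1≤k 6kn≤e fuel (subst (n <_) (sym (+-suc fuel t)) n<fuel+t)
                               (enlarge 1≤k 6kn≤e (≮⇒≥ many) (≮⇒≥ many′) P)

  toDisjointStars : ∀ {t} → Packing t → DisjointStars G k t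
  toDisjointStars P = record
    { vertex    = λ a → vertexOf P a ∘ position
    ; injective = λ a b x y e → let a≡b , x≡y = disjoint P a b _ _ e in a≡b , position-injective x≡y
    ; leafAdj   = λ a l → T-≡ .to (Star.leaf-adjacent (star P a) l)
    }
    where
    position : Maybe (Fin k) → Fin (suc k)
    position nothing  = zero
    position (just l) = suc l
    position-injective : Injective _≡_ _≡_ position
    position-injective {nothing} {nothing} _ = refl
    position-injective {just l}  {just l′} e = cong just (suc-injective e)

lemma2p4 : (k n : ℕ) → 1 ≤ k → (G : Graph n) →
    6 * k * n ≤ edgeCount G →
    Σ ℕ (λ t → DisjointStars G k t ×
      (edgeCount G < 6 * n * suc t ⊎ edgeCount G < 6 * (k * suc t) ^ 2))
lemma2p4 k n 1≤k G 6kn≤e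
  with t , P , done ← StarPacking.enlarge-until-bound G k 1≤k 6kn≤e (suc n) (s≤s (m≤m+n n 0)) (StarPacking.empty G k) =
  t , StarPacking.toDisjointStars G k P , done
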